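{- For any set $\mathcal{A}$ of Left dead-ends, the set $\mathrm{up}(\mathcal{A})$ is simply closed, i.e., closed under taking options and under disjunctive sum.
   Context: Games are finite partizan games; sum $G+H=\{G^L+H,G+H^L\mid G^R+H,G+H^R\}$. Misère outcomes: $o^L(G)=\mathscr{L}$ iff $G$ has no Left option or some $o^R(G^L)=\mathscr{L}$ (else $\mathscr{R}$); $o^R(G)=\mathscr{R}$ iff $G$ has no Right option or some $o^L(G^R)=\mathscr{R}$ (else $\mathscr{L}$); $o(G)=\mathscr{L},\mathscr{N},\mathscr{P},\mathscr{R}$ for $(o^L,o^R)=(\mathscr{L},\mathscr{L}),(\mathscr{L},\mathscr{R}),(\mathscr{R},\mathscr{L}),(\mathscr{R},\mathscr{R})$, ordered $\mathscr{L}>\mathscr{N}>\mathscr{R}$, $\mathscr{L}>\mathscr{P}>\mathscr{R}$. A Left dead-end is a game all of whose subpositions have no Left option. For Left dead-ends, $G\geq H$ means $o(G+X)\geq o(H+X)$ for all games $X$. $\mathrm{cl}(\mathcal{A})$ is the smallest set containing $\mathcal{A}$ that is closed under taking options and under sums. $\mathrm{up}(\mathcal{A})=\{G \text{ a Left dead-end}: G\geq H\text{ for some }H\in\mathrm{cl}(\mathcal{A})\}$. -}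

module Defs where

open import Data.Nat using (ℕ; zero; suc; _+_)
open import Data.Fin as Fin using (Fin; splitAt)
open import Data.Sum using (_⊎_; inj₁; inj₂; [_,_])
open import Data.Product using (Σ; _×_; _,_)
open import Relation.Binary.PropositionalEquality using (_≡_)

data Game : Set where
  mk : (nL : ℕ) → (Fin nL → Game) → (nR : ℕ) → (Fin nR → Game) → Game

-- Disjunctive sum  G + H = { G^L + H , G + H^L | G^R + H , G + H^R }.
infixl 6 _+G_
_+G_ : Game → Game → Game
G@(mk a gl b gr) +G H@(mk c hl d hr) =
  mk (a + c) (λ k → [ (λ i → gl i +G H) , (λ i → G +G hl i) ] (splitAt a k))
     (b + d) (λ k → [ (λ i → gr i +G H) , (λ i → G +G hr i) ] (splitAt b k))

data IsOption : Game → Game → Set where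
  left  : ∀ {nL gl nR gr} (i : Fin nL) → IsOption (gl i) (mk nL gl nR gr)
  right : ∀ {nL gl nR gr} (j : Fin nR) → IsOption (gr j) (mk nL gl nR gr)

data Winner : Set where
  𝓛 𝓡 : Winner

other : Winner → Winner
other 𝓛 = 𝓡
other 𝓡 = 𝓛

someIs : Winner → (n : ℕ) → (Fin n → Winner) → Winner
someIs w zero    f = other w
someIs 𝓛 (suc n) f with f Fin.zero
... | 𝓛 = 𝓛
... | 𝓡 = someIs 𝓛 n (λ i → f (Fin.suc i))
someIs 𝓡 (suc n) f with f Fin.zero
... | 𝓡 = 𝓡
... | 𝓛 = someIs 𝓡 n (λ i → f (Fin.suc i))

oL : Game → Winner
oR : Game → Winner
oL (mk zero    gl nR gr) = 𝓛
oL (mk (suc n) gl nR gr) = someIs 𝓛 (suc n) (λ i → oR (gl i))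
oR (mk nL gl zero    gr) = 𝓡
oR (mk nL gl (suc n) gr) = someIs 𝓡 (suc n) (λ j → oL (gr j))

data Outcome : Set where
  ℒ 𝒩 𝒫 ℛ : Outcome

outcome : Game → Outcome
outcome G with oL G | oR G
... | 𝓛 | 𝓛 = ℒ
... | 𝓛 | 𝓡 = 𝒩
... | 𝓡 | 𝓛 = 𝒫
... | 𝓡 | 𝓡 = ℛ

data _≥O_ : Outcome → Outcome → Set where
  refl≥ : ∀ {o} → o ≥O o
  ℒ≥𝒩 : ℒ ≥O 𝒩
  ℒ≥𝒫 : ℒ ≥O 𝒫
  ℒ≥ℛ : ℒ ≥O ℛ
  𝒩≥ℛ : 𝒩 ≥O ℛ
  𝒫≥ℛ : 𝒫 ≥O ℛ

-- Left dead-end: no subposition has a Left option.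
LeftDeadEnd : Game → Set
LeftDeadEnd (mk nL gl nR gr) = (nL ≡ 0) × ((j : Fin nR) → LeftDeadEnd (gr j))

_≥G_ : Game → Game → Set
G ≥G H = (X : Game) → outcome (G +G X) ≥O outcome (H +G X)

data cl (A : Game → Set) : Game → Set where
  base : ∀ {G} → A G → cl A G
  opt  : ∀ {G G'} → cl A G → IsOption G' G → cl A G'
  sum  : ∀ {G H} → cl A G → cl A H → cl A (G +G H)

up : (Game → Set) → Game → Set
up A G = LeftDeadEnd G × Σ Game (λ H → cl A H × (G ≥G H))

SimplyClosed : (Game → Set) → Set
SimplyClosed S =
  ((G G' : Game) → S G → IsOption G' G → S G')
  × ((G H : Game) → S G → S H → S (G +G H))

-- Between Left dead-ends, G ≥ H holds exactly when G ⊒ H for the hereditary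
-- simulation ⊒ below: every Right option of G dominates some Right option of H,
-- every Left option of H is dominated by some Left option of G, and the end
-- conditions match.  The simulation is a congruence for sums and forces
-- o(G) ≥ o(H), so it implies G ≥ H for arbitrary games.  Conversely, if it fails
-- between dead-ends, an explicit game X separates o(G + X) from o(H + X).
-- Hence from G ≥ H ∈ cl(A) each G^R satisfies G^R ≥ H^R for some H^R ∈ cl(A),
-- and G ≥ H, G' ≥ H' give G + G' ≥ H + H' ∈ cl(A).

module Submission where

open import Defs
open import Data.Nat using (ℕ; zero; suc; _+_)
open import Data.Nat.Properties using (m+n≡0⇒m≡0; m+n≡0⇒n≡0)
open import Data.Fin as Fin using (Fin; splitAt; _↑ˡ_; _↑ʳ_)
open import Data.Fin.Properties using (¬Fin0; splitAt-↑ˡ; splitAt-↑ʳ)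
open import Data.Sum as Sum using (_⊎_; inj₁; inj₂)
open import Data.Product using (Σ; _×_; _,_; proj₁; map₂)
open import Data.Empty using (⊥-elim)
open import Relation.Nullary using (¬_)
open import Relation.Binary.PropositionalEquality
  using (_≡_; refl; sym; trans; cong; cong₂)

nL nR : Game → ℕ
nL (mk a _ _ _) = a
nR (mk _ _ b _) = b

gL : (G : Game) → Fin (nL G) → Game
gL (mk _ gl _ _) = gl

gR : (G : Game) → Fin (nR G) → Game
gR (mk _ _ _ gr) = gr

rightOption : ∀ G j → IsOption (gR G j) G
rightOption (mk _ _ _ _) j = right j

_∈L_ _∈R_ : Game → Game → Set
G' ∈L G = Σ (Fin (nL G)) λ i → gL G i ≡ G'
G' ∈R G = Σ (Fin (nR G)) λ j → gR G j ≡ G'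

¬Fin-≡0 : ∀ {n} → n ≡ 0 → ¬ Fin n
¬Fin-≡0 refl = ¬Fin0

zeroG : Game
zeroG = mk 0 (λ ()) 0 (λ ())

leftOnly : (n : ℕ) → (Fin n → Game) → Game
leftOnly n f = mk n f 0 (λ ())

leftChain : ℕ → Game
leftChain zero    = zeroG
leftChain (suc m) = leftOnly 1 (λ _ → leftChain m)

leftOption-+ˡ : ∀ G H i → (gL G i +G H) ∈L (G +G H)
leftOption-+ˡ G@(mk a gl _ _) H@(mk c hl _ _) i =
  i ↑ˡ c , cong Sum.[ (λ i → gl i +G H) , (λ j → G +G hl j) ] (splitAt-↑ˡ a i c)

leftOption-+ʳ : ∀ G H j → (G +G gL H j) ∈L (G +G H)
leftOption-+ʳ G@(mk a gl _ _) H@(mk c hl _ _) j =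
  a ↑ʳ j , cong Sum.[ (λ i → gl i +G H) , (λ j → G +G hl j) ] (splitAt-↑ʳ a c j)

rightOption-+ˡ : ∀ G H i → (gR G i +G H) ∈R (G +G H)
rightOption-+ˡ G@(mk _ _ b gr) H@(mk _ _ d hr) i =
  i ↑ˡ d , cong Sum.[ (λ i → gr i +G H) , (λ j → G +G hr j) ] (splitAt-↑ˡ b i d)

rightOption-+ʳ : ∀ G H j → (G +G gR H j) ∈R (G +G H)
rightOption-+ʳ G@(mk _ _ b gr) H@(mk _ _ d hr) j =
  b ↑ʳ j , cong Sum.[ (λ i → gr i +G H) , (λ j → G +G hr j) ] (splitAt-↑ʳ b d j)

allLeft-+ : (P : Game → Set) → ∀ G H
  → (∀ i → P (gL G i +G H)) → (∀ j → P (G +G gL H j)) → ∀ k → P (gL (G +G H) k)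
allLeft-+ P (mk a _ _ _) (mk _ _ _ _) f g k with splitAt a k
... | inj₁ i = f i
... | inj₂ j = g j

allRight-+ : (P : Game → Set) → ∀ G H
  → (∀ i → P (gR G i +G H)) → (∀ j → P (G +G gR H j)) → ∀ k → P (gR (G +G H) k)
allRight-+ P (mk _ _ b _) (mk _ _ _ _) f g k with splitAt b k
... | inj₁ i = f i
... | inj₂ j = g j

anyLeft-+ : (P : Game → Set) → ∀ G H → Σ (Fin (nL (G +G H))) (λ k → P (gL (G +G H) k))
  → Σ (Fin (nL G)) (λ i → P (gL G i +G H)) ⊎ Σ (Fin (nL H)) (λ j → P (G +G gL H j))
anyLeft-+ P (mk a _ _ _) (mk _ _ _ _) (k , p) with splitAt a k
... | inj₁ i = inj₁ (i , p)
... | inj₂ j = inj₂ (j , p)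

other-≢ : ∀ {v} w → ¬ v ≡ w → v ≡ other w
other-≢ {𝓛} 𝓛 p = ⊥-elim (p refl)
other-≢ {𝓛} 𝓡 p = refl
other-≢ {𝓡} 𝓛 p = refl
other-≢ {𝓡} 𝓡 p = ⊥-elim (p refl)

𝓛≢𝓡 : ¬ 𝓛 ≡ 𝓡
𝓛≢𝓡 ()

contraposeᴿ : ∀ {v w} → (v ≡ 𝓡 → w ≡ 𝓡) → w ≡ 𝓛 → v ≡ 𝓛
contraposeᴿ {𝓛} f q = refl
contraposeᴿ {𝓡} f q = ⊥-elim (𝓛≢𝓡 (trans (sym q) (f refl)))

contraposeᴸ : ∀ {v w} → (v ≡ 𝓛 → w ≡ 𝓛) → w ≡ 𝓡 → v ≡ 𝓡
contraposeᴸ {𝓡} f q = refl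
contraposeᴸ {𝓛} f q = ⊥-elim (𝓛≢𝓡 (trans (sym (f refl)) q))

someIs-intro : ∀ w n (f : Fin n → Winner) i → f i ≡ w → someIs w n f ≡ w
someIs-intro 𝓛 (suc n) f Fin.zero p rewrite p = refl
someIs-intro 𝓡 (suc n) f Fin.zero p rewrite p = refl
someIs-intro 𝓛 (suc n) f (Fin.suc i) p with f Fin.zero
... | 𝓛 = refl
... | 𝓡 = someIs-intro 𝓛 n (λ i → f (Fin.suc i)) i p
someIs-intro 𝓡 (suc n) f (Fin.suc i) p with f Fin.zero
... | 𝓡 = refl
... | 𝓛 = someIs-intro 𝓡 n (λ i → f (Fin.suc i)) i p

someIs-elim : ∀ w n (f : Fin n → Winner) → someIs w n f ≡ w → Σ (Fin n) λ i → f i ≡ w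
someIs-elim 𝓛 (suc n) f p with f Fin.zero in eq
... | 𝓛 = Fin.zero , eq
... | 𝓡 with someIs-elim 𝓛 n (λ i → f (Fin.suc i)) p
...   | i , q = Fin.suc i , q
someIs-elim 𝓡 (suc n) f p with f Fin.zero in eq
... | 𝓡 = Fin.zero , eq
... | 𝓛 with someIs-elim 𝓡 n (λ i → f (Fin.suc i)) p
...   | i , q = Fin.suc i , q

someIs-none : ∀ w n (f : Fin n → Winner) → (∀ i → f i ≡ other w) → someIs w n f ≡ other w
someIs-none 𝓛 zero    f h = refl
someIs-none 𝓡 zero    f h = refl
someIs-none 𝓛 (suc n) f h rewrite h Fin.zero =
  someIs-none 𝓛 n (λ i → f (Fin.suc i)) (λ i → h (Fin.suc i))
someIs-none 𝓡 (suc n) f h rewrite h Fin.zero =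
  someIs-none 𝓡 n (λ i → f (Fin.suc i)) (λ i → h (Fin.suc i))

oL≡𝓛-noMove : ∀ G → nL G ≡ 0 → oL G ≡ 𝓛
oL≡𝓛-noMove (mk zero _ _ _) _ = refl

oL≡𝓛-winningMove : ∀ G {G'} → G' ∈L G → oR G' ≡ 𝓛 → oL G ≡ 𝓛
oL≡𝓛-winningMove (mk (suc n) gl _ _) (i , refl) = someIs-intro 𝓛 (suc n) (λ i → oR (gl i)) i

oL≡𝓛⇒ : ∀ G → oL G ≡ 𝓛 → nL G ≡ 0 ⊎ Σ (Fin (nL G)) λ i → oR (gL G i) ≡ 𝓛
oL≡𝓛⇒ (mk zero _ _ _)       p = inj₁ refl
oL≡𝓛⇒ (mk (suc n) gl _ _) p = inj₂ (someIs-elim 𝓛 (suc n) (λ i → oR (gl i)) p)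

oL≡𝓡⇒ : ∀ G {G'} → oL G ≡ 𝓡 → G' ∈L G → oR G' ≡ 𝓡
oL≡𝓡⇒ G p m = other-≢ 𝓛 λ q → 𝓛≢𝓡 (trans (sym (oL≡𝓛-winningMove G m q)) p)

oL≡𝓡-allMovesLose : ∀ G → Fin (nL G) → (∀ i → oR (gL G i) ≡ 𝓡) → oL G ≡ 𝓡
oL≡𝓡-allMovesLose (mk (suc n) gl _ _) _ = someIs-none 𝓛 (suc n) (λ i → oR (gl i))

oR≡𝓡-noMove : ∀ G → nR G ≡ 0 → oR G ≡ 𝓡
oR≡𝓡-noMove (mk _ _ zero _) _ = refl

oR≡𝓡-winningMove : ∀ G {G'} → G' ∈R G → oL G' ≡ 𝓡 → oR G ≡ 𝓡
oR≡𝓡-winningMove (mk _ _ (suc n) gr) (j , refl) = someIs-intro 𝓡 (suc n) (λ j → oL (gr j)) j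

oR≡𝓡⇒ : ∀ G → oR G ≡ 𝓡 → nR G ≡ 0 ⊎ Σ (Fin (nR G)) λ j → oL (gR G j) ≡ 𝓡
oR≡𝓡⇒ (mk _ _ zero _)       p = inj₁ refl
oR≡𝓡⇒ (mk _ _ (suc n) gr) p = inj₂ (someIs-elim 𝓡 (suc n) (λ j → oL (gr j)) p)

oR≡𝓛-allMovesLose : ∀ G → Fin (nR G) → (∀ j → oL (gR G j) ≡ 𝓛) → oR G ≡ 𝓛
oR≡𝓛-allMovesLose (mk _ _ (suc n) gr) _ = someIs-none 𝓡 (suc n) (λ j → oL (gr j))

-- The order on outcomes is the product order on the two first-player winners.

leftStart rightStart : Outcome → Winner
leftStart ℒ = 𝓛
leftStart 𝒩 = 𝓛
leftStart 𝒫 = 𝓡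
leftStart ℛ = 𝓡
rightStart ℒ = 𝓛
rightStart 𝒩 = 𝓡
rightStart 𝒫 = 𝓛
rightStart ℛ = 𝓡

leftStart-outcome : ∀ G → leftStart (outcome G) ≡ oL G
leftStart-outcome G with oL G | oR G
... | 𝓛 | 𝓛 = refl
... | 𝓛 | 𝓡 = refl
... | 𝓡 | 𝓛 = refl
... | 𝓡 | 𝓡 = refl

rightStart-outcome : ∀ G → rightStart (outcome G) ≡ oR G
rightStart-outcome G with oL G | oR G
... | 𝓛 | 𝓛 = refl
... | 𝓛 | 𝓡 = refl
... | 𝓡 | 𝓛 = refl
... | 𝓡 | 𝓡 = refl

≥O⇒leftStart : ∀ {o o'} → o ≥O o' → leftStart o' ≡ 𝓛 → leftStart o ≡ 𝓛
≥O⇒leftStart refl≥ p = p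
≥O⇒leftStart ℒ≥𝒩 p = refl
≥O⇒leftStart ℒ≥𝒫 p = refl
≥O⇒leftStart ℒ≥ℛ p = refl
≥O⇒leftStart 𝒩≥ℛ p = refl
≥O⇒leftStart 𝒫≥ℛ ()

≥O⇒rightStart : ∀ {o o'} → o ≥O o' → rightStart o ≡ 𝓡 → rightStart o' ≡ 𝓡
≥O⇒rightStart refl≥ p = p
≥O⇒rightStart ℒ≥𝒩 p = refl
≥O⇒rightStart ℒ≥𝒫 ()
≥O⇒rightStart ℒ≥ℛ p = refl
≥O⇒rightStart 𝒩≥ℛ p = refl
≥O⇒rightStart 𝒫≥ℛ p = refl

≥O-intro : ∀ o o' → (leftStart o' ≡ 𝓛 → leftStart o ≡ 𝓛)
  → (rightStart o ≡ 𝓡 → rightStart o' ≡ 𝓡) → o ≥O o'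
≥O-intro ℒ ℒ p q = refl≥
≥O-intro ℒ 𝒩 p q = ℒ≥𝒩
≥O-intro ℒ 𝒫 p q = ℒ≥𝒫
≥O-intro ℒ ℛ p q = ℒ≥ℛ
≥O-intro 𝒩 𝒩 p q = refl≥
≥O-intro 𝒩 ℛ p q = 𝒩≥ℛ
≥O-intro 𝒫 𝒫 p q = refl≥
≥O-intro 𝒫 ℛ p q = 𝒫≥ℛ
≥O-intro ℛ ℛ p q = refl≥
≥O-intro 𝒩 ℒ p q with q refl
... | ()
≥O-intro 𝒩 𝒫 p q with q refl
... | ()
≥O-intro 𝒫 ℒ p q with p refl
... | ()
≥O-intro 𝒫 𝒩 p q with p refl
... | ()
≥O-intro ℛ ℒ p q with p refl
... | ()
≥O-intro ℛ 𝒩 p q with p refl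
... | ()
≥O-intro ℛ 𝒫 p q with q refl
... | ()

outcome-≥ : ∀ G H → (oL H ≡ 𝓛 → oL G ≡ 𝓛) → (oR G ≡ 𝓡 → oR H ≡ 𝓡)
  → outcome G ≥O outcome H
outcome-≥ G H p q = ≥O-intro (outcome G) (outcome H)
  (λ e → trans (leftStart-outcome G) (p (trans (sym (leftStart-outcome H)) e)))
  (λ e → trans (rightStart-outcome H) (q (trans (sym (rightStart-outcome G)) e)))

outcome-≥⇒oL : ∀ G H → outcome G ≥O outcome H → oL H ≡ 𝓛 → oL G ≡ 𝓛
outcome-≥⇒oL G H g e =
  trans (sym (leftStart-outcome G)) (≥O⇒leftStart g (trans (leftStart-outcome H) e))

outcome-≥⇒oR : ∀ G H → outcome G ≥O outcome H → oR G ≡ 𝓡 → oR H ≡ 𝓡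
outcome-≥⇒oR G H g e =
  trans (sym (rightStart-outcome H)) (≥O⇒rightStart g (trans (rightStart-outcome G) e))

infix 4 _⊒_
data _⊒_ : Game → Game → Set where
  sim : ∀ {G H}
    → (nL H ≡ 0 → nL G ≡ 0)
    → (nR G ≡ 0 → nR H ≡ 0)
    → (∀ j → Σ (Fin (nL G)) λ i → gL G i ⊒ gL H j)
    → (∀ i → Σ (Fin (nR H)) λ j → gR G i ⊒ gR H j)
    → G ⊒ H

⊒-refl : ∀ G → G ⊒ G
⊒-refl (mk _ gl _ gr) =
  sim (λ e → e) (λ e → e) (λ j → j , ⊒-refl (gl j)) (λ i → i , ⊒-refl (gr i))

≡0-+ : ∀ {a b c d : ℕ} → (a ≡ 0 → c ≡ 0) → (b ≡ 0 → d ≡ 0) → a + b ≡ 0 → c + d ≡ 0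
≡0-+ {a} f g e = cong₂ _+_ (f (m+n≡0⇒m≡0 a e)) (g (m+n≡0⇒n≡0 a e))

⊒-+ : ∀ {G H G' H'} → G ⊒ H → G' ⊒ H' → G +G G' ⊒ H +G H'
⊒-+ {G@(mk _ _ _ _)} {H@(mk _ _ _ _)} {G'@(mk _ _ _ _)} {H'@(mk _ _ _ _)}
    r@(sim endL endR matchL matchR) r'@(sim endL' endR' matchL' matchR') =
  sim (≡0-+ endL endL') (≡0-+ endR endR')
    (allLeft-+ (λ Z → Σ _ λ k → gL (G +G G') k ⊒ Z) H H'
      (λ j → let (i , s) = matchL j in
        viaLeft (G +G G') (leftOption-+ˡ G G' i) (⊒-+ s r'))
      (λ j → let (i , s) = matchL' j in
        viaLeft (G +G G') (leftOption-+ʳ G G' i) (⊒-+ r s)))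
    (allRight-+ (λ Z → Σ _ λ k → Z ⊒ gR (H +G H') k) G G'
      (λ i → let (j , s) = matchR i in
        viaRight (H +G H') (rightOption-+ˡ H H' j) (⊒-+ s r'))
      (λ i → let (j , s) = matchR' i in
        viaRight (H +G H') (rightOption-+ʳ H H' j) (⊒-+ r s)))
  where
  viaLeft : ∀ K {Z Z'} → Z' ∈L K → Z' ⊒ Z → Σ (Fin (nL K)) λ k → gL K k ⊒ Z
  viaLeft _ (k , refl) s = k , s
  viaRight : ∀ K {Z Z'} → Z' ∈R K → Z ⊒ Z' → Σ (Fin (nR K)) λ k → Z ⊒ gR K k
  viaRight _ (k , refl) s = k , s

⊒⇒oL : ∀ {G H} → G ⊒ H → oL H ≡ 𝓛 → oL G ≡ 𝓛
⊒⇒oR : ∀ {G H} → G ⊒ H → oR G ≡ 𝓡 → oR H ≡ 𝓡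

⊒⇒oL {G} {H} (sim endL _ matchL _) p with oL≡𝓛⇒ H p
... | inj₁ e       = oL≡𝓛-noMove G (endL e)
... | inj₂ (j , q) = let (i , s) = matchL j in
  oL≡𝓛-winningMove G (i , refl) (contraposeᴿ (⊒⇒oR s) q)

⊒⇒oR {G} {H} (sim _ endR _ matchR) p with oR≡𝓡⇒ G p
... | inj₁ e       = oR≡𝓡-noMove H (endR e)
... | inj₂ (i , q) = let (j , s) = matchR i in
  oR≡𝓡-winningMove H (j , refl) (contraposeᴸ (⊒⇒oL s) q)

⊒⇒≥G : ∀ {G H} → G ⊒ H → G ≥G H
⊒⇒≥G {G} {H} r X =
  let s = ⊒-+ r (⊒-refl X) in outcome-≥ (G +G X) (H +G X) (⊒⇒oL s) (⊒⇒oR s)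

deadEnd-nL : ∀ G → LeftDeadEnd G → nL G ≡ 0
deadEnd-nL (mk _ _ _ _) (e , _) = e

deadEnd-R : ∀ G → LeftDeadEnd G → ∀ j → LeftDeadEnd (gR G j)
deadEnd-R (mk _ _ _ _) (_ , d) = d

deadEnd-+ : ∀ G H → LeftDeadEnd G → LeftDeadEnd H → LeftDeadEnd (G +G H)
deadEnd-+ G@(mk _ _ _ gr) H@(mk _ _ _ hr) (refl , dgr) (refl , dhr) =
  refl , allRight-+ LeftDeadEnd G H
    (λ i → deadEnd-+ (gr i) H (dgr i) (refl , dhr))
    (λ j → deadEnd-+ G (hr j) (refl , dgr) (dhr j))

deadEnd-zeroG : LeftDeadEnd zeroG
deadEnd-zeroG = refl , λ ()

deadEnd-oL : ∀ G → LeftDeadEnd G → oL G ≡ 𝓛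
deadEnd-oL G d = oL≡𝓛-noMove G (deadEnd-nL G d)

deadEnd-nL-+ : ∀ D X → LeftDeadEnd D → nL (D +G X) ≡ nL X
deadEnd-nL-+ (mk _ _ _ _) (mk _ _ _ _) (refl , _) = refl

cl-deadEnd : ∀ {A} → (∀ G → A G → LeftDeadEnd G) → ∀ {G} → cl A G → LeftDeadEnd G
cl-deadEnd A-deadEnd (base {G} a) = A-deadEnd G a
cl-deadEnd A-deadEnd (opt {G@(mk _ _ _ _)} c (left i)) =
  ⊥-elim (¬Fin-≡0 (deadEnd-nL G (cl-deadEnd A-deadEnd c)) i)
cl-deadEnd A-deadEnd (opt {G@(mk _ _ _ _)} c (right j)) = deadEnd-R G (cl-deadEnd A-deadEnd c) j
cl-deadEnd A-deadEnd (sum {G} {H} c c') =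
  deadEnd-+ G H (cl-deadEnd A-deadEnd c) (cl-deadEnd A-deadEnd c')

oL≡𝓡-deadEnd+ : ∀ D X → LeftDeadEnd D → Fin (nL X)
  → (∀ j → oR (D +G gL X j) ≡ 𝓡) → oL (D +G X) ≡ 𝓡
oL≡𝓡-deadEnd+ D X dD j₀ h =
  oL≡𝓡-allMovesLose (D +G X) (proj₁ (leftOption-+ʳ D X j₀))
    (allLeft-+ (λ Z → oR Z ≡ 𝓡) D X (λ i → ⊥-elim (¬Fin-≡0 (deadEnd-nL D dD) i)) h)

rightRun : Game → ℕ
rightRun (mk _ _ zero    _)  = 0
rightRun (mk _ _ (suc _) gr) = suc (rightRun (gr Fin.zero))

-- Right walks down D by first options while Left is forced one step down the
-- chain per Right move; both run out together, leaving Right without a move.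
oR≡𝓡-deadEnd+leftChain : ∀ D → LeftDeadEnd D → oR (D +G leftChain (rightRun D)) ≡ 𝓡
oR≡𝓡-deadEnd+leftChain (mk zero _ zero _) _ = refl
oR≡𝓡-deadEnd+leftChain D@(mk zero _ (suc _) gr) (_ , dgr) =
  oR≡𝓡-winningMove (D +G C) (rightOption-+ˡ D C Fin.zero)
    (oL≡𝓡-deadEnd+ (gr Fin.zero) C (dgr Fin.zero) Fin.zero
      (λ _ → oR≡𝓡-deadEnd+leftChain (gr Fin.zero) (dgr Fin.zero)))
  where
  C = leftChain (rightRun D)

SeparatesL SeparatesR Separates : Game → Game → Game → Set
SeparatesL G H X = oL (G +G X) ≡ 𝓡 × oL (H +G X) ≡ 𝓛
SeparatesR G H X = oR (G +G X) ≡ 𝓡 × oR (H +G X) ≡ 𝓛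
Separates G H X = SeparatesL G H X ⊎ SeparatesR G H X

separates⇒≱ : ∀ G H X → Separates G H X → ¬ (outcome (G +G X) ≥O outcome (H +G X))
separates⇒≱ G H X (inj₁ (p , q)) g =
  𝓛≢𝓡 (trans (sym (outcome-≥⇒oL (G +G X) (H +G X) g q)) p)
separates⇒≱ G H X (inj₂ (p , q)) g =
  𝓛≢𝓡 (trans (sym q) (outcome-≥⇒oR (G +G X) (H +G X) g p))

-- Left's winning first move in E + X lies in X, and the same move loses in D + X.
deadEnds-separateR : ∀ D E X → LeftDeadEnd D → LeftDeadEnd E
  → Separates D E X → Σ Game (SeparatesR D E)
deadEnds-separateR D E X _ _ (inj₂ s) = X , s
deadEnds-separateR D E X dD dE (inj₁ (p , q)) with oL≡𝓛⇒ (E +G X) q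
... | inj₁ e = ⊥-elim (𝓛≢𝓡 (trans (sym (oL≡𝓛-noMove (D +G X) noMove)) p))
  where
  noMove = trans (deadEnd-nL-+ D X dD) (trans (sym (deadEnd-nL-+ E X dE)) e)
... | inj₂ m with anyLeft-+ (λ Z → oR Z ≡ 𝓛) E X m
...   | inj₁ (i , _) = ⊥-elim (¬Fin-≡0 (deadEnd-nL E dE) i)
...   | inj₂ (j , r) = gL X j , oL≡𝓡⇒ (D +G X) p (leftOption-+ʳ D X j) , r

separate-noMove-move : ∀ G H → LeftDeadEnd H → nR G ≡ 0 → Fin (nR H)
  → Σ Game (SeparatesR G H)
separate-noMove-move G@(mk _ _ zero _) H dH _ j₀ =
  zeroG ,
  oR≡𝓡-noMove (G +G zeroG) refl ,
  oR≡𝓛-allMovesLose (H +G zeroG) (proj₁ (rightOption-+ˡ H zeroG j₀))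
    (allRight-+ (λ Z → oL Z ≡ 𝓛) H zeroG
      (λ j → deadEnd-oL (gR H j +G zeroG)
               (deadEnd-+ (gR H j) zeroG (deadEnd-R H dH j) deadEnd-zeroG))
      (λ ()))

switch : ℕ → Game
switch n = mk 1 (λ _ → leftChain n) 1 (λ _ → zeroG)

-- Left must enter the switch.  In G + switch, Right answers with G^R + switch,
-- forcing Left onto a chain that Right outlasts; in H + switch Right's only
-- move leaves the dead-end H, where Left, having no move, wins.
separate-move-noMove : ∀ G H → LeftDeadEnd G → LeftDeadEnd H → Fin (nR G) → nR H ≡ 0
  → Σ Game (SeparatesL G H)
separate-move-noMove G H dG dH i eH =
  X ,
  oL≡𝓡-deadEnd+ G X dG Fin.zero (λ _ → rightWinsG) ,
  oL≡𝓛-winningMove (H +G X) (leftOption-+ʳ H X Fin.zero) leftWinsH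
  where
  Gʳ = gR G i
  dGʳ = deadEnd-R G dG i
  S = switch (rightRun Gʳ)
  X = leftOnly 1 (λ _ → S)
  rightWinsG : oR (G +G S) ≡ 𝓡
  rightWinsG = oR≡𝓡-winningMove (G +G S) (rightOption-+ˡ G S i)
    (oL≡𝓡-deadEnd+ Gʳ S dGʳ Fin.zero (λ _ → oR≡𝓡-deadEnd+leftChain Gʳ dGʳ))
  leftWinsH : oR (H +G S) ≡ 𝓛
  leftWinsH = oR≡𝓛-allMovesLose (H +G S) (proj₁ (rightOption-+ʳ H S Fin.zero))
    (allRight-+ (λ Z → oL Z ≡ 𝓛) H S (λ j → ⊥-elim (¬Fin-≡0 eH j))
      (λ _ → deadEnd-oL (H +G zeroG) (deadEnd-+ H zeroG dH deadEnd-zeroG)))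

separate-options : ∀ G H (i : Fin (nR G)) → Fin (nR H) → LeftDeadEnd (gR G i)
  → (∀ j → Σ Game (SeparatesR (gR G i) (gR H j))) → Σ Game (SeparatesR G H)
separate-options G H i j₀ dGʳ seps = X , rightWinsG , leftWinsH
  where
  Y = λ j → let (Yⱼ , _) = seps j in Yⱼ
  X = leftOnly (nR H) Y
  rightWinsG : oR (G +G X) ≡ 𝓡
  rightWinsG = oR≡𝓡-winningMove (G +G X) (rightOption-+ˡ G X i)
    (oL≡𝓡-deadEnd+ (gR G i) X dGʳ j₀ (λ j → let (_ , p , _) = seps j in p))
  leftWinsH : oR (H +G X) ≡ 𝓛
  leftWinsH = oR≡𝓛-allMovesLose (H +G X) (proj₁ (rightOption-+ˡ H X j₀))
    (allRight-+ (λ Z → oL Z ≡ 𝓛) H X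
      (λ j → let (_ , _ , q) = seps j in
        oL≡𝓛-winningMove (gR H j +G X) (leftOption-+ʳ (gR H j) X j) q)
      (λ ()))

∃-or-∀ : ∀ {n} {P Q : Fin n → Set} → (∀ i → P i ⊎ Q i) → Σ (Fin n) P ⊎ (∀ i → Q i)
∃-or-∀ {zero}  f = inj₂ (λ ())
∃-or-∀ {suc n} f with f Fin.zero | ∃-or-∀ (λ i → f (Fin.suc i))
... | inj₁ p | _            = inj₁ (Fin.zero , p)
... | inj₂ _ | inj₁ (i , p) = inj₁ (Fin.suc i , p)
... | inj₂ q | inj₂ g       = inj₂ λ { Fin.zero → q ; (Fin.suc i) → g i }

∀-or-∃ : ∀ {n} {P Q : Fin n → Set} → (∀ i → P i ⊎ Q i) → (∀ i → P i) ⊎ Σ (Fin n) Q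
∀-or-∃ f = Sum.swap (∃-or-∀ (λ i → Sum.swap (f i)))

⊒-or-separated : ∀ G H → LeftDeadEnd G → LeftDeadEnd H
  → G ⊒ H ⊎ Σ Game (Separates G H)
⊒-or-separated (mk zero _ zero _) (mk zero _ zero _) _ _ =
  inj₁ (sim (λ _ → refl) (λ _ → refl) (λ ()) (λ ()))
⊒-or-separated G@(mk zero _ zero _) H@(mk zero _ (suc _) _) _ dH =
  inj₂ (map₂ inj₂ (separate-noMove-move G H dH refl Fin.zero))
⊒-or-separated G@(mk zero _ (suc _) _) H@(mk zero _ zero _) dG dH =
  inj₂ (map₂ inj₁ (separate-move-noMove G H dG dH Fin.zero refl))
⊒-or-separated G@(mk zero _ (suc _) gr) H@(mk zero _ (suc _) hr) (_ , dgr) (_ , dhr)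
  with ∀-or-∃ (λ i → ∃-or-∀ (λ j → ⊒-or-separated (gr i) (hr j) (dgr i) (dhr j)))
... | inj₁ matchR = inj₁ (sim (λ _ → refl) (λ ()) (λ ()) matchR)
... | inj₂ (i , seps) =
  inj₂ (map₂ inj₂ (separate-options G H i Fin.zero (dgr i) λ j →
    let (X , s) = seps j in deadEnds-separateR (gr i) (hr j) X (dgr i) (dhr j) s))

≥G⇒⊒ : ∀ G H → LeftDeadEnd G → LeftDeadEnd H → G ≥G H → G ⊒ H
≥G⇒⊒ G H dG dH G≥H with ⊒-or-separated G H dG dH
... | inj₁ r       = r
... | inj₂ (X , s) = ⊥-elim (separates⇒≱ G H X s (G≥H X))

proposition4p1 : (A : Game → Set)
    → ((G : Game) → A G → LeftDeadEnd G)
    → SimplyClosed (up A)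
proposition4p1 A A-deadEnd = options , sums
  where
  ⊒-witness : ∀ {G H} → LeftDeadEnd G → cl A H → G ≥G H → G ⊒ H
  ⊒-witness {G} {H} dG H∈cl = ≥G⇒⊒ G H dG (cl-deadEnd A-deadEnd H∈cl)

  options : (G G' : Game) → up A G → IsOption G' G → up A G'
  options G@(mk _ _ _ _) _ (dG , _) (left i) = ⊥-elim (¬Fin-≡0 (deadEnd-nL G dG) i)
  options G@(mk _ _ _ _) _ (dG , H , H∈cl , G≥H) (right i)
    with ⊒-witness dG H∈cl G≥H
  ... | sim _ _ _ matchR = let (j , s) = matchR i in
    deadEnd-R G dG i , gR H j , opt H∈cl (rightOption H j) , ⊒⇒≥G s

  sums : (G H : Game) → up A G → up A H → up A (G +G H)
  sums G H (dG , K , K∈cl , G≥K) (dH , K' , K'∈cl , H≥K') =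
    deadEnd-+ G H dG dH , K +G K' , sum K∈cl K'∈cl ,
    ⊒⇒≥G (⊒-+ (⊒-witness dG K∈cl G≥K) (⊒-witness dH K'∈cl H≥K'))
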